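{- Let $G,H$ be $\mathbf{e}$-free edge-labelled graphs, $H'$ a contraction of $H$, $\mathcal{R}\subseteq X_G\times X_H$, $C_1,\dots,C_q$ ($q\ge1$) distinct $\mathbf{e}$-connected components of $H'$ with $\{T_1,\dots,T_p\}=C_1\uplus\dots\uplus C_q$, $\mathbb{T}=(T_1,\dots,T_p)$, and $\mathbb{S}=(S_1,\dots,S_p)$ a tuple of pairwise disjoint subsets of $V_G$. For $j\in[q]$ let $I_j\subseteq[p]$ with $C_j=\{T_i:i\in I_j\}$. Then $\mathcal{R}^{\mathbb{S}}_{\mathbb{T}}=\emptyset$ if $\mathbb{S}\not\preceq_{\mathcal{R}}\mathbb{T}$, and $\mathcal{R}^{\mathbb{S}}_{\mathbb{T}}=\mathcal{R}^{\mathbb{S}_{I_1}}_{\mathbb{T}_{I_1}}\bowtie\dots\bowtie\mathcal{R}^{\mathbb{S}_{I_q}}_{\mathbb{T}_{I_q}}$ if $\mathbb{S}\preceq_{\mathcal{R}}\mathbb{T}$.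
   Context: Edge-labelled graph: $G=(V_G,l_G,X_G)$, finite $V_G,X_G$, $l_G:V_G^2\to X_G$; $\mathbf{e}$-free if the special symbol $\mathbf{e}\notin X_G$; $G[S]=(S,l_G|_{S^2},X_G)$. $\mathcal{R}$-morphism $f$ from $G$ to $H$: $(l_G(u,v),l_H(f(u),f(v)))\in\mathcal{R}$ for all $u,v$. A contraction $H'$ of $H$ relative to a partition $\mathcal{S}$ of $V_H$ into nonempty parts has vertex set $\mathcal{S}$ and label $x$ on $(T,T')$ if $l_H$ is constantly $x$ on $T\times T'$, else $\mathbf{e}$. $\mathbf{e}$-connected components: components of the undirected graph with edge $\{u,v\}$ iff $\mathbf{e}\in\{l(u,v),l(v,u)\}$. For $\mathbb{S}=(S_1,\dots,S_r)$ pairwise disjoint subsets of $V_G$ and $\mathbb{T}=(T_1,\dots,T_r)$ pairwise disjoint subsets of $V_H$, $\mathcal{R}^{\mathbb{S}}_{\mathbb{T}}$ is the set of $\mathcal{R}$-morphisms $f$ from $G[S_1\uplus\dots\uplus S_r]$ to $H[T_1\uplus\dots\uplus T_r]$ with $f(S_i)\subseteq T_i$ for all $i$; $\mathbb{S}_I$ is the subtuple indexed by $I$. $\mathbb{S}\preceq_{\mathcal{R}}\mathbb{T}$ (for $T_i$ vertices of $H'$): for all $i,i'$, if $l_{H'}(T_i,T_{i'})\neq\mathbf{e}$ then $(l_G(u,v),l_{H'}(T_i,T_{i'}))\in\mathcal{R}$ for all $(u,v)\in S_i\times S_{i'}$. Join: for $f_i:S_i\to T_i$ with disjoint $S_1,S_2$,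 $f_1\bowtie f_2:S_1\uplus S_2\to T_1\cup T_2$ restricts to $f_i$ on $S_i$; $\mathcal{F}_1\bowtie\mathcal{F}_2=\{f_1\bowtie f_2:(f_1,f_2)\in\mathcal{F}_1\times\mathcal{F}_2\}$. -}

module Defs where

open import Data.Nat using (ℕ)
open import Data.Fin using (Fin)
open import Data.Maybe using (Maybe; just; nothing)
open import Data.Product using (Σ; ∃; ∃-syntax; _×_; _,_)
open import Data.Sum using (_⊎_)
open import Relation.Nullary using (¬_)
open import Relation.Binary.PropositionalEquality using (_≡_)
open import Relation.Binary.Construct.Closure.ReflexiveTransitive using (Star)
open import Function.Bundles using (_⇔_)

-- An edge-labelled graph with vertex set Fin n and label alphabet Fin a is
-- given by a labelling  l : Fin n → Fin n → Fin a.  Such a graph is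
-- automatically e-free: the special symbol e is not an element of Fin a.
-- Labels of a contraction live in  Maybe (Fin b) , where  nothing  is e.

-- A partition of V_H = Fin m into k nonempty parts: a surjection π.
-- Part t is the set { u | π u ≡ t }.
PartSurj : ∀ {m k} → (Fin m → Fin k) → Set
PartSurj {m} π = ∀ t → ∃[ u ] π u ≡ t

ConstOn : ∀ {m k b} → (Fin m → Fin m → Fin b) → (Fin m → Fin k) →
          Fin k → Fin k → Fin b → Set
ConstOn lH π t t' x = ∀ u v → π u ≡ t → π v ≡ t' → lH u v ≡ x

IsContraction : ∀ {m k b} → (Fin m → Fin m → Fin b) → (Fin m → Fin k) →
                (Fin k → Fin k → Maybe (Fin b)) → Set
IsContraction lH π lH' =
  ∀ t t' → (∀ x → (lH' t t' ≡ just x) ⇔ ConstOn lH π t t' x)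
         × ((lH' t t' ≡ nothing) ⇔ (¬ (∃[ x ] ConstOn lH π t t' x)))

EAdj : ∀ {k b} → (Fin k → Fin k → Maybe (Fin b)) → Fin k → Fin k → Set
EAdj lH' t t' = (lH' t t' ≡ nothing) ⊎ (lH' t' t ≡ nothing)

EReach : ∀ {k b} → (Fin k → Fin k → Maybe (Fin b)) → Fin k → Fin k → Set
EReach lH' = Star (EAdj lH')

IsEComponent : ∀ {k b} → (Fin k → Fin k → Maybe (Fin b)) → (Fin k → Set) → Set
IsEComponent lH' C = ∃[ v ] (∀ w → C w ⇔ EReach lH' v w)

-- C_j = { T_i : c i ≡ j } for the tuple τ = (T_1,…,T_p) of vertices of H'.
Comp : ∀ {p q k} → (Fin p → Fin k) → (Fin p → Fin q) → Fin q → Fin k → Set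
Comp τ c j w = ∃[ i ] (c i ≡ j × τ i ≡ w)

PMap : ℕ → ℕ → Set
PMap n m = Fin n → Maybe (Fin m)

-- The set R^{S_I}_{T_I}: S = σ (σ u ≡ just i iff u ∈ S_i; pairwise disjoint),
-- T_i = part τ i of π, and I ⊆ [p] a predicate.  f is a member iff its
-- domain is exactly ⋃_{i∈I} S_i, f(S_i) ⊆ T_i for i ∈ I, and f is an
-- R-morphism from G[⋃ S_i] to H[⋃ T_i].
HomSet : ∀ {n m k a b p} → (Fin n → Fin n → Fin a) → (Fin m → Fin m → Fin b) →
         (Fin a → Fin b → Set) → (Fin m → Fin k) →
         (Fin n → Maybe (Fin p)) → (Fin p → Fin k) → (Fin p → Set) →
         PMap n m → Set
HomSet lG lH R π σ τ I f =
  (∀ u → (∀ i → σ u ≡ just i → ¬ I i) → f u ≡ nothing)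
  × (∀ u i → σ u ≡ just i → I i → ∃[ v ] (f u ≡ just v × π v ≡ τ i))
  × (∀ u u' v v' → f u ≡ just v → f u' ≡ just v' → R (lG u u') (lH v v'))

IsJoin : ∀ {n m q} → (Fin q → PMap n m) → PMap n m → Set
IsJoin g f =
  ∀ u → ((∀ j → g j u ≡ nothing) → f u ≡ nothing)
      × (∀ j v → g j u ≡ just v → f u ≡ just v)

JoinSet : ∀ {n m q} → (Fin q → PMap n m → Set) → PMap n m → Set
JoinSet {n} {m} {q} F f = ∃[ g ] ((∀ j → F j (g j)) × IsJoin g f)

Prec : ∀ {n k a b p} → (Fin n → Fin n → Fin a) → (Fin k → Fin k → Maybe (Fin b)) →
       (Fin a → Fin b → Set) → (Fin n → Maybe (Fin p)) → (Fin p → Fin k) → Set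
Prec lG lH' R σ τ =
  ∀ i i' x → lH' (τ i) (τ i') ≡ just x →
    ∀ u u' → σ u ≡ just i → σ u' ≡ just i' → R (lG u u') x

-- For u ∈ S_i and u' ∈ S_i', a morphism f must satisfy R(l_G(u,u'), l_H(f u, f u')).  If the
-- contraction labels (T_i, T_i') by x ≠ e, every edge of H between these parts carries x, so the
-- requirement is exactly R(l_G(u,u'), x): this is what S ⪯_R T demands, hence it is necessary,
-- and under S ⪯_R T it holds for every map respecting the parts.  If the label is e, then T_i and
-- T_i' lie in one e-component, so the requirement is already imposed on the restriction of f to
-- that component.  Hence f is a morphism iff each of its restrictions to a component is one.
module Submission where

open import Defs
open import Data.Nat using (ℕ; _≤_)
open import Data.Fin using (Fin; _≟_)
open import Data.Maybe using (Maybe; just; nothing)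
open import Data.Maybe.Properties using (just-injective)
open import Data.Bool using (if_then_else_)
open import Data.Product using (_×_; _,_; proj₁; proj₂; ∃-syntax)
open import Data.Sum using (inj₁)
open import Data.Unit using (⊤; tt)
open import Relation.Nullary using (¬_; does; yes; contradiction)
open import Relation.Nullary.Decidable using (dec-true; dec-false)
open import Relation.Binary.PropositionalEquality using (_≡_; refl; sym; trans; subst)
open import Relation.Binary.Construct.Closure.ReflexiveTransitive using (_◅◅_; ε; _◅_)
open import Function.Definitions using (Injective)
open import Function.Bundles using (_⇔_; mk⇔; Equivalence)

≢just⇒≡nothing : ∀ {A : Set} {x : Maybe A} → (∀ a → ¬ x ≡ just a) → x ≡ nothing
≢just⇒≡nothing {x = nothing} _   = refl
≢just⇒≡nothing {x = just a}  x≢ = contradiction refl (x≢ a)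

contraction-const : ∀ {m k b} {lH : Fin m → Fin m → Fin b} {π : Fin m → Fin k}
  {lH' : Fin k → Fin k → Maybe (Fin b)} → IsContraction lH π lH' →
  ∀ {t t' x} → lH' t t' ≡ just x → ConstOn lH π t t' x
contraction-const ic {t} {t'} {x} = Equivalence.to (proj₁ (ic t t') x)

EComponent-closed : ∀ {k b} {lH' : Fin k → Fin k → Maybe (Fin b)} {C : Fin k → Set} →
  IsEComponent lH' C → ∀ {t t'} → C t → EAdj lH' t t' → C t'
EComponent-closed (v , C⇔) {t} {t'} Ct adj =
  Equivalence.from (C⇔ t') (Equivalence.to (C⇔ t) Ct ◅◅ (adj ◅ ε))

Comp-injective : ∀ {p q k} {τ : Fin p → Fin k} {c : Fin p → Fin q} →
  Injective _≡_ _≡_ τ → ∀ {i j} → Comp τ c j (τ i) → c i ≡ j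
Comp-injective τ-inj (i' , ci'≡j , τi'≡τi) with τ-inj τi'≡τi
... | refl = ci'≡j

EAdj⇒sameComponent : ∀ {k b p q} {lH' : Fin k → Fin k → Maybe (Fin b)}
  {τ : Fin p → Fin k} {c : Fin p → Fin q} → Injective _≡_ _≡_ τ →
  (∀ j → IsEComponent lH' (Comp τ c j)) →
  ∀ {i i'} → EAdj lH' (τ i) (τ i') → c i' ≡ c i
EAdj⇒sameComponent τ-inj comps {i} adj =
  Comp-injective τ-inj (EComponent-closed (comps _) (i , refl , refl) adj)

module HomSets {n m k a b p : ℕ}
  (lG : Fin n → Fin n → Fin a) (lH : Fin m → Fin m → Fin b) (R : Fin a → Fin b → Set)
  (π : Fin m → Fin k) (σ : Fin n → Maybe (Fin p)) (τ : Fin p → Fin k) where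

  Hom : (Fin p → Set) → PMap n m → Set
  Hom = HomSet lG lH R π σ τ

  Hom⇒Prec : ∀ {lH'} → IsContraction lH π lH' → ∀ {f} → Hom (λ _ → ⊤) f → Prec lG lH' R σ τ
  Hom⇒Prec ic (_ , parts , morphism) i i' x lbl u u' su su'
    with parts u i su tt | parts u' i' su' tt
  ... | v , fu , πv | v' , fu' , πv' =
    subst (R (lG u u')) (contraction-const ic lbl v v' πv πv') (morphism u u' v v' fu fu')

  module Components {q : ℕ} (c : Fin p → Fin q) where

    restrict : PMap n m → Fin q → PMap n m
    restrict f j u with σ u
    ... | nothing = nothing
    ... | just i  = if does (c i ≟ j) then f u else nothing

    restrict-inside : ∀ f {j u i} → σ u ≡ just i → c i ≡ j → restrict f j u ≡ f u
    restrict-inside f {j} su ci≡j rewrite su | dec-true (c _ ≟ j) ci≡j = refl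

    restrict-outside : ∀ f {j u} → (∀ i → σ u ≡ just i → ¬ c i ≡ j) → restrict f j u ≡ nothing
    restrict-outside f {j} {u} outside with σ u
    ... | nothing = refl
    ... | just i rewrite dec-false (c i ≟ j) (outside i refl) = refl

    restrict-just : ∀ f {j u v} → restrict f j u ≡ just v → f u ≡ just v
    restrict-just f {j} {u} fu with σ u
    ... | just i with c i ≟ j
    ...   | yes _ = fu

    restrict-Hom : ∀ {f} → Hom (λ _ → ⊤) f → ∀ j → Hom (λ i → c i ≡ j) (restrict f j)
    restrict-Hom {f} (_ , parts , morphism) j =
        (λ _ outside → restrict-outside f outside)
      , (λ u i su ci≡j → subst (λ w → ∃[ v ] (w ≡ just v × π v ≡ τ i))
                                (sym (restrict-inside f su ci≡j)) (parts u i su tt))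
      , (λ u u' v v' fu fu' → morphism u u' v v' (restrict-just f fu) (restrict-just f fu'))

    restrict-IsJoin : ∀ {f} → Hom (λ _ → ⊤) f → IsJoin (restrict f) f
    restrict-IsJoin {f} (undefined , _ , _) u = undefined-when (σ u) refl , λ j v → restrict-just f
      where
      undefined-when : ∀ s → σ u ≡ s → (∀ j → restrict f j u ≡ nothing) → f u ≡ nothing
      undefined-when nothing  su _    = undefined u λ i su' → contradiction (trans (sym su) su') λ ()
      undefined-when (just i) su none = trans (sym (restrict-inside f su refl)) (none (c i))

    module _ {g : Fin q → PMap n m} (g∈ : ∀ j → Hom (λ i → c i ≡ j) (g j))
             {f : PMap n m} (f≡⋈g : IsJoin g f) where

      join-extends : ∀ {j u v} → g j u ≡ just v → f u ≡ just v
      join-extends {j} {u} {v} = proj₂ (f≡⋈g u) j v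

      join-outside : ∀ {u} → σ u ≡ nothing → f u ≡ nothing
      join-outside {u} su = proj₁ (f≡⋈g u) λ j →
        proj₁ (g∈ j) u λ i su' → contradiction (trans (sym su) su') λ ()

      join-defined : ∀ {u v} → f u ≡ just v → ∃[ i ] σ u ≡ just i
      join-defined {u} fu with σ u in su
      ... | just i  = i , refl
      ... | nothing = contradiction (trans (sym fu) (join-outside su)) λ ()

      component-defined : ∀ {u i} → σ u ≡ just i → ∃[ v ] (g (c i) u ≡ just v × π v ≡ τ i)
      component-defined {u} {i} su = proj₁ (proj₂ (g∈ (c i))) u i su refl

      join-at : ∀ {u i v} → σ u ≡ just i → f u ≡ just v → g (c i) u ≡ just v × π v ≡ τ i
      join-at su fu with component-defined su
      ... | w , gu , πw with just-injective (trans (sym fu) (join-extends gu))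
      ...   | refl = gu , πw

      JoinSet⇒Hom : ∀ {lH'} → IsContraction lH π lH' → Injective _≡_ _≡_ τ →
        (∀ j → IsEComponent lH' (Comp τ c j)) → Prec lG lH' R σ τ → Hom (λ _ → ⊤) f
      JoinSet⇒Hom {lH'} ic τ-inj comps S⪯T =
          (λ u outside → join-outside (≢just⇒≡nothing λ i su → outside i su tt))
        , (λ u i su _ → let v , gu , πv = component-defined su in v , join-extends gu , πv)
        , morphism
        where
        morphism : ∀ u u' v v' → f u ≡ just v → f u' ≡ just v' → R (lG u u') (lH v v')
        morphism u u' v v' fu fu' with join-defined fu | join-defined fu'
        ... | i , su | i' , su' with join-at su fu | join-at su' fu'
        ... | gu , πv | gu' , πv' with lH' (τ i) (τ i') in lbl
        ... | just x  = subst (R (lG u u')) (sym (contraction-const ic lbl v v' πv πv'))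
                              (S⪯T i i' x lbl u u' su su')
        ... | nothing = proj₂ (proj₂ (g∈ (c i))) u u' v v' gu
                          (subst (λ j → g j u' ≡ just v') sameComponent gu')
          where
          sameComponent : c i' ≡ c i
          sameComponent = EAdj⇒sameComponent τ-inj comps (inj₁ lbl)

lemma1 : ∀ {n m k a b p q : ℕ}
    (lG : Fin n → Fin n → Fin a) (lH : Fin m → Fin m → Fin b)
    (π : Fin m → Fin k) → PartSurj π →
    (lH' : Fin k → Fin k → Maybe (Fin b)) → IsContraction lH π lH' →
    (R : Fin a → Fin b → Set) →
    1 ≤ q →
    (τ : Fin p → Fin k) → Injective _≡_ _≡_ τ →
    (c : Fin p → Fin q) → (∀ j → IsEComponent lH' (Comp τ c j)) →
    (σ : Fin n → Maybe (Fin p)) →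
    (¬ Prec lG lH' R σ τ → ∀ f → ¬ HomSet lG lH R π σ τ (λ _ → ⊤) f)
    × (Prec lG lH' R σ τ → ∀ f →
        HomSet lG lH R π σ τ (λ _ → ⊤) f
          ⇔ JoinSet (λ j → HomSet lG lH R π σ τ (λ i → c i ≡ j)) f)
lemma1 lG lH π _ lH' ic R _ τ τ-inj c comps σ =
    (λ S⋠T f f∈ → S⋠T (Hom⇒Prec ic f∈))
  , λ S⪯T f → mk⇔
      (λ f∈ → restrict f , restrict-Hom f∈ , restrict-IsJoin f∈)
      (λ (g , g∈ , f≡⋈g) → JoinSet⇒Hom g∈ f≡⋈g ic τ-inj comps S⪯T)
  where
  open HomSets lG lH R π σ τ
  open Components c
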